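{- Let $d\ge1$, $1\le r\le d$, and let $n\ge3$ be odd. Let $A_0=\{x\in[n]^d: x_1+\dots+x_d\equiv0\pmod 2\}$. If $\omega$ is a configuration on $\mathbb{T}_n^d$ in which every vertex of $A_0$ is active, then $\omega$ is a dynamo under reversible $r$-bootstrap percolation.
   Context: The $d$-dimensional torus $\mathbb{T}_n^d$ is the graph with vertex set $[n]^d=\{1,\dots,n\}^d$, where two vertices are adjacent iff they differ in exactly one coordinate $j$ and in that coordinate $x_j-x'_j\equiv\pm1\pmod n$. A configuration assigns each vertex a state active (1) or inactive (0). In reversible $r$-bootstrap percolation, in each round, simultaneously, every vertex becomes active if it has at least $r$ active neighbors and inactive otherwise. A dynamo is an initial configuration such that from some time on all vertices are active in all subsequent rounds. -}

module Defs where

open import Data.Nat using (ℕ; zero; suc; _+_; _≤_; _≤ᵇ_; _%_; NonZero)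
open import Data.Nat.Properties using ()
open import Data.Bool using (Bool; true; false; if_then_else_)
open import Data.Fin using (Fin; toℕ; fromℕ<)
open import Data.Fin.Properties using ()
open import Data.List using (List; []; _∷_; _++_; map; concatMap; length; filter; allFin)
open import Data.Nat.ListAction using (sum)
open import Data.Product using (Σ; ∃; _×_; _,_)
open import Relation.Binary.PropositionalEquality using (_≡_)
open import Function using (_∘_)
open import Data.Nat.DivMod using (m%n<n)
open import Relation.Nullary.Decidable using (⌊_⌋)
import Data.Fin

-- Vertices of the torus T_n^d: functions Fin d → Fin n.
-- Coordinate value k : Fin n represents the paper's coordinate k+1 ∈ [n].
Vertex : ℕ → ℕ → Set
Vertex n d = Fin d → Fin n

Config : ℕ → ℕ → Set
Config n d = Vertex n d → Bool

update : ∀ {n d} → Vertex n d → Fin d → Fin n → Vertex n d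
update x j a i = if ⌊ i Data.Fin.≟ j ⌋ then a else x i

succMod : ∀ n .{{_ : NonZero n}} → Fin n → Fin n
succMod n k = fromℕ< (m%n<n (suc (toℕ k)) n)

predMod : ∀ n .{{_ : NonZero n}} → Fin n → Fin n
predMod (suc m) k = fromℕ< (m%n<n (toℕ k + m) (suc m))

-- The list of neighbours of x in T_n^d: for each coordinate j,
-- change x_j by +1 and by -1 modulo n.  (For n ≥ 3 these 2d vertices are
-- pairwise distinct, so this is exactly the neighbourhood.)
neighbours : ∀ {n d} .{{_ : NonZero n}} → Vertex n d → List (Vertex n d)
neighbours {n} {d} x =
  concatMap (λ j → update x j (succMod n (x j)) ∷ update x j (predMod n (x j)) ∷ []) (allFin d)

activeNeighbours : ∀ {n d} .{{_ : NonZero n}} → Config n d → Vertex n d → ℕ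
activeNeighbours ω x = length (filter (λ y → ω y Data.Bool.≟ true) (neighbours x))

step : ∀ {n d} .{{_ : NonZero n}} → ℕ → Config n d → Config n d
step r ω x = r ≤ᵇ activeNeighbours ω x

run : ∀ {n d} .{{_ : NonZero n}} → ℕ → ℕ → Config n d → Config n d
run r zero    ω = ω
run r (suc t) ω = step r (run r t ω)

Dynamo : ∀ {n d} .{{_ : NonZero n}} → ℕ → Config n d → Set
Dynamo {n} {d} r ω = ∃ λ T → ∀ t → T ≤ t → ∀ (x : Vertex n d) → run r t ω x ≡ true

-- sum of the coordinates x_1 + ... + x_d in the paper's 1-based convention
coordSum : ∀ {n d} → Vertex n d → ℕ
coordSum {d = d} x = sum (map (λ j → suc (toℕ (x j))) (allFin d))

InA0 : ∀ {n d} → Vertex n d → Set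
InA0 x = coordSum x % 2 ≡ 0

-- Write h(x) for the sum of the 0-based coordinates of x, so that A₀ is the set of x
-- with h(x) ≡ d (mod 2). By induction on t, a vertex x is active at time t as soon as
-- h(x) ≡ t + d (mod 2) or h(x) < t. For the inductive step it suffices to find, in each
-- of the d coordinate directions, one such neighbour for time t. If h(x) ≡ t + 1 + d, a
-- unit step that does not wrap around flips the parity of h. If h(x) ≤ t, stepping down
-- either lowers h or wraps from 0 to n − 1, which preserves the parity of h as n is odd.
-- Since h(x) ≤ d (n − 1), every vertex is active from time d (n − 1) + 1 on.
module Submission where

open import Defs
open import Data.Nat using (ℕ; _≤_; _%_; NonZero)
open import Data.Bool using (true)
open import Relation.Binary.PropositionalEquality using (_≡_)

open import Data.Bool as Bool using (Bool; false)
open import Data.Bool.Properties using (T-≡)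
open import Data.Empty using (⊥-elim)
open import Data.Fin as Fin using (Fin; toℕ; zero; suc)
open import Data.Fin.Properties using (toℕ-fromℕ<; toℕ<n; suc-injective)
open import Data.List using (List; []; _∷_; length; filter; tabulate; allFin; concatMap)
open import Data.List.Properties using (map-tabulate; length-tabulate; tabulate-cong)
open import Data.Nat as ℕ using (suc; _+_; _*_; _<_; z≤n; s≤s; parity)
open import Data.Nat.DivMod using ([m+n]%n≡m%n; m<n⇒m%n≡m)
open import Data.Nat.ListAction using (sum)
open import Data.Nat.Properties
  using (≤-refl; ≤-reflexive; ≤-trans; <-≤-trans; n≤1+n; n<1+n; m<n⇒m<1+n; +-mono-≤; +-suc; +-comm; +-assoc;
         +-identityʳ; +-cancelʳ-≡; ≤⇒≤ᵇ)
open import Data.Parity.Base as ℙ using (0ℙ; 1ℙ; _⁻¹)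
open import Data.Parity.Properties using (suc-homo-⁻¹; +-homo-+; p+p≡0ℙ; ⁻¹-selfInverse; ⁻¹-involutive)
open import Data.Product using (_,_)
open import Data.Sum using (_⊎_; inj₁; inj₂)
open import Function using (_∘_; id; Equivalence)
open import Relation.Nullary using (yes; no)
open import Relation.Binary.PropositionalEquality using (refl; sym; trans; cong; _≢_; module ≡-Reasoning)

private
  variable
    m n d : ℕ

parity-suc : ∀ k → parity (suc k) ≡ parity k ⁻¹
parity-suc k = sym (⁻¹-selfInverse (suc-homo-⁻¹ k))

parity-+-even : ∀ k {l} → parity l ≡ 0ℙ → parity (k + l) ≡ parity k
parity-+-even k {l} even = begin
  parity (k + l)          ≡⟨ +-homo-+ k l ⟩
  parity k ℙ.+ parity l   ≡⟨ cong (parity k ℙ.+_) even ⟩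
  parity k ℙ.+ 0ℙ         ≡⟨ Data.Parity.Properties.+-identityʳ (parity k) ⟩
  parity k                ∎
  where open ≡-Reasoning

≡⊎≡⁻¹ : ∀ p q → p ≡ q ⊎ p ≡ q ⁻¹
≡⊎≡⁻¹ 0ℙ 0ℙ = inj₁ refl
≡⊎≡⁻¹ 0ℙ 1ℙ = inj₂ refl
≡⊎≡⁻¹ 1ℙ 0ℙ = inj₂ refl
≡⊎≡⁻¹ 1ℙ 1ℙ = inj₁ refl

parity≡0ℙ⇒%2≡0 : ∀ k → parity k ≡ 0ℙ → k % 2 ≡ 0
parity≡0ℙ⇒%2≡0 0             _    = refl
parity≡0ℙ⇒%2≡0 (suc (suc k)) even = parity≡0ℙ⇒%2≡0 k even

%2≡1⇒parity≡1ℙ : ∀ k → k % 2 ≡ 1 → parity k ≡ 1ℙ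
%2≡1⇒parity≡1ℙ 1             _   = refl
%2≡1⇒parity≡1ℙ (suc (suc k)) odd = %2≡1⇒parity≡1ℙ k odd

sum-tabulate-exchange : (f g : Fin d → ℕ) (j : Fin d) → (∀ i → i ≢ j → f i ≡ g i) →
  sum (tabulate f) + g j ≡ sum (tabulate g) + f j
sum-tabulate-exchange {suc d} f g zero agree = begin
  (f zero + F) + g zero ≡⟨ +-assoc (f zero) F (g zero) ⟩
  f zero + (F + g zero) ≡⟨ cong (f zero +_) (+-comm F (g zero)) ⟩
  f zero + (g zero + F) ≡⟨ +-comm (f zero) (g zero + F) ⟩
  (g zero + F) + f zero ≡⟨ cong (λ s → (g zero + s) + f zero) F≡G ⟩
  (g zero + G) + f zero ∎
  where
  open ≡-Reasoning
  F = sum (tabulate (f ∘ suc))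
  G = sum (tabulate (g ∘ suc))
  F≡G : F ≡ G
  F≡G = cong sum (tabulate-cong (λ i → agree (suc i) λ ()))
sum-tabulate-exchange {suc d} f g (suc j) agree = begin
  (f zero + F) + g (suc j) ≡⟨ +-assoc (f zero) F _ ⟩
  f zero + (F + g (suc j)) ≡⟨ cong (_+ (F + g (suc j))) (agree zero λ ()) ⟩
  g zero + (F + g (suc j)) ≡⟨ cong (g zero +_) exchanged ⟩
  g zero + (G + f (suc j)) ≡⟨ +-assoc (g zero) G _ ⟨
  (g zero + G) + f (suc j) ∎
  where
  open ≡-Reasoning
  F = sum (tabulate (f ∘ suc))
  G = sum (tabulate (g ∘ suc))
  exchanged : F + g (suc j) ≡ G + f (suc j)
  exchanged = sum-tabulate-exchange (f ∘ suc) (g ∘ suc) j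
    (λ i i≢j → agree (suc i) (i≢j ∘ suc-injective))

sum-tabulate-suc : (f : Fin d → ℕ) → sum (tabulate (suc ∘ f)) ≡ sum (tabulate f) + d
sum-tabulate-suc {0}     f = refl
sum-tabulate-suc {suc d} f = begin
  suc (f zero + sum (tabulate (suc ∘ f ∘ suc))) ≡⟨ cong (ℕ.suc ∘ (f zero +_)) (sum-tabulate-suc (f ∘ suc)) ⟩
  suc (f zero + (sum (tabulate (f ∘ suc)) + d)) ≡⟨ cong suc (+-assoc (f zero) _ d) ⟨
  suc (f zero + sum (tabulate (f ∘ suc)) + d)   ≡⟨ +-suc _ d ⟨
  f zero + sum (tabulate (f ∘ suc)) + suc d     ∎
  where open ≡-Reasoning

sum-tabulate-≤ : ∀ {c} (f : Fin d → ℕ) → (∀ i → f i ≤ c) → sum (tabulate f) ≤ d * c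
sum-tabulate-≤ {0}     f bound = z≤n
sum-tabulate-≤ {suc d} f bound = +-mono-≤ (bound zero) (sum-tabulate-≤ (f ∘ suc) (bound ∘ suc))

length-filter-∷-≤ : ∀ {A : Set} (p : A → Bool) y xs →
  length (filter (λ z → p z Bool.≟ true) xs) ≤ length (filter (λ z → p z Bool.≟ true) (y ∷ xs))
length-filter-∷-≤ p y xs with p y
... | true  = n≤1+n _
... | false = ≤-refl

length≤#true-pairs : ∀ {A D : Set} (p : A → Bool) (a b : D → A) (js : List D) →
  (∀ j → p (a j) ≡ true ⊎ p (b j) ≡ true) →
  length js ≤ length (filter (λ z → p z Bool.≟ true) (concatMap (λ j → a j ∷ b j ∷ []) js))
length≤#true-pairs p a b []       one-true = z≤n
length≤#true-pairs p a b (j ∷ js) one-true with p (a j) | one-true j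
... | true  | _       = s≤s (≤-trans (length≤#true-pairs p a b js one-true) (length-filter-∷-≤ p (b j) _))
... | false | inj₂ bj rewrite bj = s≤s (length≤#true-pairs p a b js one-true)

toℕ-succMod : .{{_ : NonZero n}} (a : Fin n) → suc (toℕ a) < n → toℕ (succMod n a) ≡ suc (toℕ a)
toℕ-succMod {n} a lt = trans (toℕ-fromℕ< _) (m<n⇒m%n≡m lt)

toℕ-predMod-zero : toℕ (predMod (suc m) zero) ≡ m
toℕ-predMod-zero {m} = trans (toℕ-fromℕ< _) (m<n⇒m%n≡m (n<1+n m))

toℕ-predMod-suc : (b : Fin m) → toℕ (predMod (suc m) (suc b)) ≡ toℕ b
toℕ-predMod-suc {m} b = begin
  toℕ (predMod (suc m) (suc b)) ≡⟨ toℕ-fromℕ< _ ⟩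
  suc (toℕ b + m) % suc m       ≡⟨ cong (_% suc m) (+-suc (toℕ b) m) ⟨
  (toℕ b + suc m) % suc m       ≡⟨ [m+n]%n≡m%n (toℕ b) (suc m) ⟩
  toℕ b % suc m                 ≡⟨ m<n⇒m%n≡m (m<n⇒m<1+n (toℕ<n b)) ⟩
  toℕ b                         ∎
  where open ≡-Reasoning

update-≡ : (x : Vertex n d) → ∀ j a → update x j a j ≡ a
update-≡ x j a with j Fin.≟ j
... | yes _   = refl
... | no j≢j = ⊥-elim (j≢j refl)

update-≢ : (x : Vertex n d) → ∀ j a i → i ≢ j → update x j a i ≡ x i
update-≢ x j a i i≢j with i Fin.≟ j
... | yes i≡j = ⊥-elim (i≢j i≡j)
... | no _    = refl

height : Vertex n d → ℕ
height x = sum (tabulate (toℕ ∘ x))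

coordSum≡height+d : (x : Vertex n d) → coordSum x ≡ height x + d
coordSum≡height+d {d = d} x =
  trans (cong sum (map-tabulate id (suc ∘ toℕ ∘ x))) (sum-tabulate-suc (toℕ ∘ x))

height-≤ : (x : Vertex (suc m) d) → height x ≤ d * m
height-≤ x = sum-tabulate-≤ (toℕ ∘ x) (ℕ.s≤s⁻¹ ∘ toℕ<n ∘ x)

height-update : (x : Vertex n d) → ∀ j a {u v} → toℕ (x j) ≡ u → toℕ a ≡ v →
  height (update x j a) + u ≡ height x + v
height-update x j a refl refl = begin
  height (update x j a) + toℕ (x j) ≡⟨ sum-tabulate-exchange _ _ j (λ i → cong toℕ ∘ update-≢ x j a i) ⟩
  height x + toℕ (update x j a j)   ≡⟨ cong (λ b → height x + toℕ b) (update-≡ x j a) ⟩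
  height x + toℕ a                  ∎
  where open ≡-Reasoning

up down : .{{_ : NonZero n}} → Vertex n d → Fin d → Vertex n d
up   {n} x j = update x j (succMod n (x j))
down {n} x j = update x j (predMod n (x j))

height-up-zero : (x : Vertex (suc m) d) → ∀ j → x j ≡ zero → 1 < suc m → height (up x j) ≡ suc (height x)
height-up-zero {m} x j xj≡0 1<n = begin
  height (up x j)     ≡⟨ +-identityʳ _ ⟨
  height (up x j) + 0 ≡⟨ height-update x j _ (cong toℕ xj≡0) succMod≡1 ⟩
  height x + 1        ≡⟨ +-comm (height x) 1 ⟩
  suc (height x)      ∎
  where
  open ≡-Reasoning
  succMod≡1 : toℕ (succMod (suc m) (x j)) ≡ 1
  succMod≡1 = trans (cong (toℕ ∘ succMod (suc m)) xj≡0) (toℕ-succMod zero 1<n)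

height-down-zero : (x : Vertex (suc m) d) → ∀ j → x j ≡ zero → height (down x j) ≡ height x + m
height-down-zero {m} x j xj≡0 = trans (sym (+-identityʳ _))
  (height-update x j _ (cong toℕ xj≡0) (trans (cong (toℕ ∘ predMod (suc m)) xj≡0) toℕ-predMod-zero))

height-down-suc : (x : Vertex (suc m) d) → ∀ j {b} → x j ≡ suc b → suc (height (down x j)) ≡ height x
height-down-suc {m} x j {b} xj≡1+b = +-cancelʳ-≡ (toℕ b) _ _ (trans (sym (+-suc _ (toℕ b)))
  (height-update x j _ (cong toℕ xj≡1+b) (trans (cong (toℕ ∘ predMod (suc m)) xj≡1+b) (toℕ-predMod-suc b))))

step-true : .{{_ : NonZero n}} {r : ℕ} (ω : Config n d) (x : Vertex n d) → r ≤ d →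
  (∀ j → ω (up x j) ≡ true ⊎ ω (down x j) ≡ true) → step r ω x ≡ true
step-true {d = d} {r} ω x r≤d one-active = Equivalence.to T-≡ (≤⇒≤ᵇ (begin
  r                    ≤⟨ r≤d ⟩
  d                    ≡⟨ length-tabulate id ⟨
  length (allFin d)    ≤⟨ length≤#true-pairs ω (up x) (down x) (allFin d) one-active ⟩
  activeNeighbours ω x ∎))
  where open Data.Nat.Properties.≤-Reasoning

module OddTorus (1<n : 1 < suc m) (m-even : parity m ≡ 0ℙ) where

  neighbour-of-parity : ∀ {p} (x : Vertex (suc m) d) → ∀ j → parity (height x) ≡ p ⁻¹ →
    parity (height (up x j)) ≡ p ⊎ parity (height (down x j)) ≡ p
  neighbour-of-parity {p = p} x j opposite = by-cases (x j) refl
    where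
    open ≡-Reasoning
    by-cases : ∀ a → x j ≡ a → parity (height (up x j)) ≡ p ⊎ parity (height (down x j)) ≡ p
    by-cases zero xj = inj₁ (begin
      parity (height (up x j))            ≡⟨ cong parity (height-up-zero x j xj 1<n) ⟩
      parity (suc (height x))             ≡⟨ parity-suc (height x) ⟩
      parity (height x) ⁻¹                ≡⟨ cong _⁻¹ opposite ⟩
      p ⁻¹ ⁻¹                             ≡⟨ ⁻¹-involutive p ⟩
      p                                   ∎)
    by-cases (suc b) xj = inj₂ (begin
      parity (height (down x j))          ≡⟨ ⁻¹-involutive _ ⟨
      parity (height (down x j)) ⁻¹ ⁻¹    ≡⟨ cong _⁻¹ (parity-suc (height (down x j))) ⟨
      parity (suc (height (down x j))) ⁻¹ ≡⟨ cong (_⁻¹ ∘ parity) (height-down-suc x j xj) ⟩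
      parity (height x) ⁻¹                ≡⟨ cong _⁻¹ opposite ⟩
      p ⁻¹ ⁻¹                             ≡⟨ ⁻¹-involutive p ⟩
      p                                   ∎)

  down-lower-or-same-parity : (x : Vertex (suc m) d) → ∀ j →
    height (down x j) < height x ⊎ parity (height (down x j)) ≡ parity (height x)
  down-lower-or-same-parity x j = by-cases (x j) refl
    where
    by-cases : ∀ a → x j ≡ a → height (down x j) < height x ⊎ parity (height (down x j)) ≡ parity (height x)
    by-cases zero    xj = inj₂ (trans (cong parity (height-down-zero x j xj)) (parity-+-even (height x) m-even))
    by-cases (suc b) xj = inj₁ (≤-reflexive (height-down-suc x j xj))

  Active : ℕ → Vertex (suc m) d → Set
  Active {d} t x = parity (height x) ≡ parity (t + d) ⊎ height x < t

  opposite-parity⇒Active-neighbour : ∀ t (x : Vertex (suc m) d) j → parity (height x) ≡ parity (t + d) ⁻¹ →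
    Active t (up x j) ⊎ Active t (down x j)
  opposite-parity⇒Active-neighbour t x j opposite = Data.Sum.map inj₁ inj₁ (neighbour-of-parity x j opposite)

  Active-step : ∀ {t} (x : Vertex (suc m) d) → Active (suc t) x → ∀ j → Active t (up x j) ⊎ Active t (down x j)
  Active-step {t = t} x (inj₁ opposite) j =
    opposite-parity⇒Active-neighbour t x j (trans opposite (parity-suc (t + _)))
  Active-step {t = t} x (inj₂ (s≤s h≤t)) j with ≡⊎≡⁻¹ (parity (height x)) (parity (t + _))
  ... | inj₂ opposite = opposite-parity⇒Active-neighbour t x j opposite
  ... | inj₁ same with down-lower-or-same-parity x j
  ...   | inj₁ lower  = inj₂ (inj₂ (<-≤-trans lower h≤t))
  ...   | inj₂ kept   = inj₂ (inj₁ (trans kept same))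

  Active-zero⇒InA0 : (x : Vertex (suc m) d) → Active 0 x → InA0 x
  Active-zero⇒InA0 {d} x (inj₁ same) = parity≡0ℙ⇒%2≡0 (coordSum x) (begin
    parity (coordSum x)             ≡⟨ cong parity (coordSum≡height+d x) ⟩
    parity (height x + d)           ≡⟨ +-homo-+ (height x) d ⟩
    parity (height x) ℙ.+ parity d  ≡⟨ cong (ℙ._+ parity d) same ⟩
    parity d ℙ.+ parity d           ≡⟨ p+p≡0ℙ (parity d) ⟩
    0ℙ                              ∎)
    where open ≡-Reasoning

module Bootstrap {r : ℕ} (r≤d : r ≤ d) (1<n : 1 < suc m) (m-even : parity m ≡ 0ℙ)
  (ω : Config (suc m) d) (A₀-active : (x : Vertex (suc m) d) → InA0 x → ω x ≡ true) where

  open OddTorus 1<n m-even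

  active-at : ∀ t x → Active t x → run r t ω x ≡ true
  active-at 0       x active = A₀-active x (Active-zero⇒InA0 x active)
  active-at (suc t) x active = step-true (run r t ω) x r≤d
    (Data.Sum.map (active-at t _) (active-at t _) ∘ Active-step x active)

lemma4 : (d r n : ℕ) → .{{_ : NonZero n}} → 1 ≤ d → 1 ≤ r → r ≤ d → 3 ≤ n → n % 2 ≡ 1 →
    (ω : Config n d) → ((x : Vertex n d) → InA0 x → ω x ≡ true) →
    Dynamo r ω
lemma4 d r (suc m) _ _ r≤d 3≤n odd ω A₀-active =
  suc (d * m) , λ t T≤t x → active-at t x (inj₂ (<-≤-trans (s≤s (height-≤ x)) T≤t))
  where
  1<n : 1 < suc m
  1<n = ≤-trans (s≤s (s≤s z≤n)) 3≤n
  m-even : parity m ≡ 0ℙ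
  m-even = trans (sym (suc-homo-⁻¹ m)) (cong _⁻¹ (%2≡1⇒parity≡1ℙ (suc m) odd))
  open Bootstrap r≤d 1<n m-even ω A₀-active
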